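{- Let $\mathcal D=(\mathcal P,\mathcal B)$ be a $G$-locally transitive design. Then $\mathcal D$ is $G$-flag-transitive. If the stabilizer $G_\beta$ is $2$-homogeneous on $\mathcal D(\beta)$ for each $\beta\in\mathcal B$, then $G$ is $2$-homogeneous on $\mathcal P$. Further, if $G_\beta$ is $2$-transitive on $\mathcal D(\beta)$ for each $\beta\in\mathcal B$, then $G$ is $2$-transitive on $\mathcal P$.
   Context: A design $\mathcal D=(\mathcal P,\mathcal B)$: $\mathcal P$ a finite set of $v$ points, $\mathcal B$ a set of blocks, each a $k$-subset of $\mathcal P$ with $k<v$, such that any two distinct points lie in exactly $\lambda>0$ common blocks; designs are simple and non-trivial ($\mathcal B$ is not the set of all $k$-subsets). A flag is a pair $(\alpha,\beta)$ with $\alpha\in\beta$. For a point $\alpha$, $\mathcal D(\alpha)$ is the set of blocks containing $\alpha$; for a block $\beta$, $\mathcal D(\beta)=\beta$. For $G\leqslant\mathrm{Aut}(\mathcal D)$ (permutations of $\mathcal P$ preserving $\mathcal B$), $\mathcal D$ is $G$-locally transitive if $G_\gamma$ is transitive on $\mathcal D(\gamma)$ for every $\gamma\in\mathcal P\cup\mathcal B$, and $G$-flag-transitive if $G$ is transitive on the set of flags. -}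

module Defs where

open import Data.Nat using (ℕ; _<_)
open import Data.Fin using (Fin)
open import Data.Fin.Subset as S using (Subset; ∣_∣)
open import Data.Fin.Subset.Properties using (_∈?_)
open import Data.Fin.Permutation using (Permutation′; _⟨$⟩ʳ_; _⟨$⟩ˡ_; id; flip; _∘ₚ_)
open import Data.Vec using (tabulate; lookup)
open import Data.List using (List; length; filter)
open import Data.List.Membership.Propositional as L using ()
open import Data.List.Relation.Unary.Unique.Propositional using (Unique)
open import Data.Product using (Σ; ∃-syntax; _×_; _,_)
open import Data.Sum using (_⊎_)
open import Relation.Nullary using (¬_)
open import Relation.Nullary.Decidable using (_×-dec_)
open import Relation.Binary.PropositionalEquality using (_≡_; _≢_)

-- A 2-(v,k,λ) design on the point set Fin v; blocks are subsets of Fin v,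
-- listed without repetition (simple design).
record Design (v : ℕ) : Set where
  field
    k    : ℕ
    lam  : ℕ
    blocks : List (Subset v)
    k<v : k < v
    lam>0 : 0 < lam
    simple : Unique blocks
    block-size : ∀ {b} → b L.∈ blocks → ∣ b ∣ ≡ k
    balanced : ∀ (x y : Fin v) → x ≢ y →
      length (filter (λ b → (x ∈? b) ×-dec (y ∈? b)) blocks) ≡ lam
    nontrivial : ∃[ b ] (∣ b ∣ ≡ k × ¬ (b L.∈ blocks))

image : ∀ {v} → Permutation′ v → Subset v → Subset v
image g b = tabulate (λ i → lookup b (g ⟨$⟩ˡ i))

record IsSubgroup {v : ℕ} (G : Permutation′ v → Set) : Set where
  field
    has-id : G id
    closed-∘ : ∀ {g h} → G g → G h → G (g ∘ₚ h)
    closed-inv : ∀ {g} → G g → G (flip g)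

record IsAutGroup {v : ℕ} (D : Design v) (G : Permutation′ v → Set) : Set where
  open Design D
  field
    subgroup : IsSubgroup G
    preserves : ∀ {g} → G g → ∀ b → (b L.∈ blocks → image g b L.∈ blocks)
    reflects  : ∀ {g} → G g → ∀ b → (image g b L.∈ blocks → b L.∈ blocks)

module _ {v : ℕ} (D : Design v) (G : Permutation′ v → Set) where
  open Design D

  PointLocallyTransitive : Set
  PointLocallyTransitive = ∀ (α : Fin v) (β β′ : Subset v) →
    β L.∈ blocks → α S.∈ β → β′ L.∈ blocks → α S.∈ β′ →
    ∃[ g ] (G g × g ⟨$⟩ʳ α ≡ α × image g β ≡ β′)

  -- G_β transitive on D(β) = β, for every block β
  BlockLocallyTransitive : Set
  BlockLocallyTransitive = ∀ (β : Subset v) → β L.∈ blocks →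
    ∀ (x y : Fin v) → x S.∈ β → y S.∈ β →
    ∃[ g ] (G g × image g β ≡ β × g ⟨$⟩ʳ x ≡ y)

  LocallyTransitive : Set
  LocallyTransitive = PointLocallyTransitive × BlockLocallyTransitive

  FlagTransitive : Set
  FlagTransitive = ∀ (α α′ : Fin v) (β β′ : Subset v) →
    β L.∈ blocks → α S.∈ β → β′ L.∈ blocks → α′ S.∈ β′ →
    ∃[ g ] (G g × g ⟨$⟩ʳ α ≡ α′ × image g β ≡ β′)

  Block2Homogeneous : Set
  Block2Homogeneous = ∀ (β : Subset v) → β L.∈ blocks →
    ∀ (x y x′ y′ : Fin v) → x S.∈ β → y S.∈ β → x′ S.∈ β → y′ S.∈ β →
    x ≢ y → x′ ≢ y′ →
    ∃[ g ] (G g × image g β ≡ β ×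
      ((g ⟨$⟩ʳ x ≡ x′ × g ⟨$⟩ʳ y ≡ y′) ⊎ (g ⟨$⟩ʳ x ≡ y′ × g ⟨$⟩ʳ y ≡ x′)))

  Block2Transitive : Set
  Block2Transitive = ∀ (β : Subset v) → β L.∈ blocks →
    ∀ (x y x′ y′ : Fin v) → x S.∈ β → y S.∈ β → x′ S.∈ β → y′ S.∈ β →
    x ≢ y → x′ ≢ y′ →
    ∃[ g ] (G g × image g β ≡ β × g ⟨$⟩ʳ x ≡ x′ × g ⟨$⟩ʳ y ≡ y′)

TwoHomogeneous : ∀ {v} → (Permutation′ v → Set) → Set
TwoHomogeneous {v} G = ∀ (x y x′ y′ : Fin v) → x ≢ y → x′ ≢ y′ →
  ∃[ g ] (G g × ((g ⟨$⟩ʳ x ≡ x′ × g ⟨$⟩ʳ y ≡ y′) ⊎ (g ⟨$⟩ʳ x ≡ y′ × g ⟨$⟩ʳ y ≡ x′)))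

TwoTransitive : ∀ {v} → (Permutation′ v → Set) → Set
TwoTransitive {v} G = ∀ (x y x′ y′ : Fin v) → x ≢ y → x′ ≢ y′ →
  ∃[ g ] (G g × g ⟨$⟩ʳ x ≡ x′ × g ⟨$⟩ʳ y ≡ y′)

{-# OPTIONS --safe #-}
module Submission where

-- Since λ > 0, any two points lie in a common block γ. A flag (α , β) is then
-- carried to (α′ , β′) in three local moves: turn β about α onto a block γ
-- through α and α′ (point stabiliser), slide α to α′ inside γ (block
-- stabiliser), and turn γ about α′ onto β′. For two pairs {x , y} and
-- {x′ , y′} of distinct points, flag-transitivity carries a block through x and
-- y onto a block β′ through x′ and y′; the action of G_β′ on β′ finishes.

open import Defs
open import Data.Nat using (ℕ; _<_)
open import Data.Fin using (Fin; _≟_)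
open import Data.Fin.Subset as S using (Subset; inside)
open import Data.Fin.Subset.Properties using (_∈?_)
open import Data.Fin.Permutation using (Permutation′; _⟨$⟩ʳ_; _⟨$⟩ˡ_; _∘ₚ_; inverseˡ)
open import Data.Vec using (tabulate; lookup)
open import Data.Vec.Properties using (lookup∘tabulate; tabulate-cong; []=⇒lookup; lookup⇒[]=)
open import Data.List using (List; _∷_; length; filter)
open import Data.List.Membership.Propositional as L using ()
open import Data.List.Membership.Propositional.Properties using (∈-filter⁻)
open import Data.List.Relation.Unary.Any using (here)
open import Data.Product using (_×_; _,_; ∃-syntax)
open import Function.Base using (_∘′_)
open import Function.Bundles using (Injection)
open import Function.Properties.Inverse using (↔⇒↣)
open import Relation.Nullary using (Dec; yes; no)
open import Relation.Nullary.Decidable using (_×-dec_)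
open import Relation.Binary.PropositionalEquality

∃-∈-of-0<length : ∀ {A : Set} (xs : List A) → 0 < length xs → ∃[ a ] a L.∈ xs
∃-∈-of-0<length (a ∷ _) _ = a , here refl

permute-≢ : ∀ {v} (g : Permutation′ v) {x y : Fin v} → x ≢ y → g ⟨$⟩ʳ x ≢ g ⟨$⟩ʳ y
permute-≢ g x≢y = x≢y ∘′ Injection.injective (↔⇒↣ g)

image-∘ : ∀ {v} (g h : Permutation′ v) (b : Subset v) →
  image (g ∘ₚ h) b ≡ image h (image g b)
image-∘ g h b =
  tabulate-cong (λ i → sym (lookup∘tabulate (λ j → lookup b (g ⟨$⟩ˡ j)) (h ⟨$⟩ˡ i)))

∈-image : ∀ {v} (g : Permutation′ v) {b : Subset v} {x : Fin v} →
  x S.∈ b → g ⟨$⟩ʳ x S.∈ image g b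
∈-image g {b} {x} x∈b = lookup⇒[]= _ _ (begin
  lookup (image g b) (g ⟨$⟩ʳ x)  ≡⟨ lookup∘tabulate (λ j → lookup b (g ⟨$⟩ˡ j)) (g ⟨$⟩ʳ x) ⟩
  lookup b (g ⟨$⟩ˡ (g ⟨$⟩ʳ x))   ≡⟨ cong (lookup b) (inverseˡ g) ⟩
  lookup b x                     ≡⟨ []=⇒lookup x∈b ⟩
  inside                         ∎)
  where open ≡-Reasoning

both∈? : ∀ {v} (x y : Fin v) (b : Subset v) → Dec (x S.∈ b × y S.∈ b)
both∈? x y b = (x ∈? b) ×-dec (y ∈? b)

module _ {v} (D : Design v) where
  open Design D

  common-block : ∀ {x y : Fin v} → x ≢ y → ∃[ β ] (β L.∈ blocks × x S.∈ β × y S.∈ β)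
  common-block {x} {y} x≢y
    with ∃-∈-of-0<length (filter (both∈? x y) blocks)
           (subst (0 <_) (sym (balanced x y x≢y)) lam>0)
  ... | β , β∈filter = β , ∈-filter⁻ (both∈? x y) {xs = blocks} β∈filter

_~[_]_ : ∀ {v} → Fin v × Subset v → (Permutation′ v → Set) → Fin v × Subset v → Set
(α , β) ~[ G ] (α′ , β′) = ∃[ g ] (G g × g ⟨$⟩ʳ α ≡ α′ × image g β ≡ β′)

-- The source block is not recoverable from an `image` equation by unification,
-- so callers name it via the implicit β.
~-trans : ∀ {v} {G : Permutation′ v → Set} → IsSubgroup G →
  ∀ {α α′ α″ : Fin v} {β β′ β″ : Subset v} →
  (α , β) ~[ G ] (α′ , β′) → (α′ , β′) ~[ G ] (α″ , β″) → (α , β) ~[ G ] (α″ , β″)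
~-trans H {β = β} (g , Gg , gα , gβ) (h , Gh , hα′ , hβ′) =
  g ∘ₚ h , IsSubgroup.closed-∘ H Gg Gh , trans (cong (h ⟨$⟩ʳ_) gα) hα′ ,
  trans (image-∘ g h β) (trans (cong (image h) gβ) hβ′)

module _ {v} (D : Design v) {G : Permutation′ v → Set} where
  open Design D

  flag-transitive : IsSubgroup G →
    PointLocallyTransitive D G → BlockLocallyTransitive D G → FlagTransitive D G
  flag-transitive H plt blt α α′ β β′ β∈ α∈β β′∈ α′∈β′ with α ≟ α′
  ... | yes refl = plt α β β′ β∈ α∈β β′∈ α′∈β′
  ... | no α≢α′ with common-block D α≢α′
  ... | γ , γ∈ , α∈γ , α′∈γ =
    ~-trans H {β = β} (plt α β γ β∈ α∈β γ∈ α∈γ)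
      (~-trans H {β = γ} slide (plt α′ γ β′ γ∈ α′∈γ β′∈ α′∈β′))
    where
    slide : (α , γ) ~[ G ] (α′ , γ)
    slide with blt γ γ∈ α α′ α∈γ α′∈γ
    ... | g , Gg , gγ , gα = g , Gg , gα , gγ

  pair-into-block : FlagTransitive D G → ∀ {x y x′ y′ : Fin v} → x ≢ y → x′ ≢ y′ →
    ∃[ g ] ∃[ β ] (G g × β L.∈ blocks ×
      g ⟨$⟩ʳ x S.∈ β × g ⟨$⟩ʳ y S.∈ β × x′ S.∈ β × y′ S.∈ β)
  pair-into-block flag {x} {y} {x′} {y′} x≢y x′≢y′
    with common-block D x≢y | common-block D x′≢y′
  ... | β , β∈ , x∈β , y∈β | β′ , β′∈ , x′∈β′ , y′∈β′
    with flag x x′ β β′ β∈ x∈β β′∈ x′∈β′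
  ... | g , Gg , _ , refl =
    g , image g β , Gg , β′∈ , ∈-image g x∈β , ∈-image g y∈β , x′∈β′ , y′∈β′

  two-homogeneous : IsSubgroup G → FlagTransitive D G →
    Block2Homogeneous D G → TwoHomogeneous G
  two-homogeneous H flag b2h x y x′ y′ x≢y x′≢y′ with pair-into-block flag x≢y x′≢y′
  ... | g , β , Gg , β∈ , gx∈β , gy∈β , x′∈β , y′∈β
    with b2h β β∈ _ _ x′ y′ gx∈β gy∈β x′∈β y′∈β (permute-≢ g x≢y) x′≢y′
  ... | h , Gh , _ , sends = g ∘ₚ h , IsSubgroup.closed-∘ H Gg Gh , sends

  two-transitive : IsSubgroup G → FlagTransitive D G →
    Block2Transitive D G → TwoTransitive G
  two-transitive H flag b2t x y x′ y′ x≢y x′≢y′ with pair-into-block flag x≢y x′≢y′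
  ... | g , β , Gg , β∈ , gx∈β , gy∈β , x′∈β , y′∈β
    with b2t β β∈ _ _ x′ y′ gx∈β gy∈β x′∈β y′∈β (permute-≢ g x≢y) x′≢y′
  ... | h , Gh , _ , sends = g ∘ₚ h , IsSubgroup.closed-∘ H Gg Gh , sends

lemma2p2 : ∀ (v : ℕ) (D : Design v) (G : Permutation′ v → Set) →
    IsAutGroup D G → LocallyTransitive D G →
    FlagTransitive D G
    × (Block2Homogeneous D G → TwoHomogeneous G)
    × (Block2Transitive D G → TwoTransitive G)
lemma2p2 v D G aut (plt , blt) = flag , two-homogeneous D H flag , two-transitive D H flag
  where
  H : IsSubgroup G
  H = IsAutGroup.subgroup aut

  flag : FlagTransitive D G
  flag = flag-transitive D H plt blt
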